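{- Let $n\ge 3$, $k\in\{2,\ldots,n-1\}$, $T^{k,n}=(N_1,\ldots,N_t)$ the problem instance defined in the context (so $t=\binom{n-1}{k}2^k$), and $1\le s\le t$. Let $N$ be an optimal solution for $T^{k,n}$. Then $f_{T^{k,n}}(N_s)\ge \tfrac{3}{2}\,f_{T^{k,n}}(N)$.
   Context: Binary attributes $V_1,\ldots,V_n$, each with domain $\{0,1\}$. For $Q\subseteq\{V_1,\ldots,V_{n-1}\}$, $\mathrm{Inst}(Q)$ is the set of assignments of values in $\{0,1\}$ to the attributes of $Q$ (contexts). A (complete) CPT $N$ for $V_n$ consists of a parent set $Pa(N,V_n)\subseteq\{V_1,\ldots,V_{n-1}\}$ and, for each $\gamma\in\mathrm{Inst}(Pa(N,V_n))$, exactly one rule, either $\gamma:0\succ 1$ or $\gamma:1\succ 0$. A swap over $V_n$ is identified with an element $x\in\{0,1\}^{n-1}$; the vote of $N$ on $x$ is $0$ if the rule of $N$ whose context agrees with $x$ on $Pa(N,V_n)$ is of the form $\gamma:0\succ1$, and $1$ otherwise. $\Delta(N,N')$ is the number of swaps on which $N,N'$ vote differently. For a problem instance $T=(N_1,\ldots,N_t)$ (tuple of CPTs for $V_n$), $f_T(N)=\sum_{s=1}^t\Delta(N,N_s)$; an optimal solution for $T$ is a CPT for $V_n$ (any parent set $\subseteq\{V_1,\ldots,V_{n-1}\}$) minimizing $f_T$. The instance $T^{k,n}=(N_1,\ldots,N_t)$ has $t=\binom{n-1}{k}2^k$, with the indices $s$ in bijection with the pairs $(P,\gamma)$ where $P$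 is a $k$-element subset of $\{V_1,\ldots,V_{n-1}\}$ and $\gamma\in\mathrm{Inst}(P)$; the CPT $N_s$ corresponding to $(P,\gamma)$ has parent set $P$, the rule $\gamma:1\succ0$, and the rule $\gamma':0\succ1$ for every $\gamma'\in\mathrm{Inst}(P)\setminus\{\gamma\}$. -}

module Defs where

open import Data.Nat using (ℕ; zero; suc; _+_; _*_; _≤_; _∸_; _≡ᵇ_)
open import Data.Bool using (Bool; true; false; if_then_else_; _∧_; _xor_)
open import Data.Bool.Properties using () renaming (_≟_ to _≟B_)
open import Data.Unit using (⊤; tt)
open import Data.Product using (_×_; _,_)
open import Data.Vec using (Vec; []; _∷_)
open import Data.Fin.Subset using (Subset; ∣_∣)
open import Relation.Nullary using (does)

-- Attributes V_1..V_m (m = n-1) are indexed by Fin m.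
-- Boolean encoding of a value in {0,1}: false = 0, true = 1.
-- A swap over V_n is an element x ∈ {0,1}^m, i.e. Vec Bool m.

Inst : ∀ {m} → Subset m → Set
Inst [] = ⊤
Inst (true ∷ Q) = Bool × Inst Q
Inst (false ∷ Q) = Inst Q

instEq : ∀ {m} (Q : Subset m) → Inst Q → Inst Q → Bool
instEq [] _ _ = true
instEq (true ∷ Q) (a , g) (b , h) = does (a ≟B b) ∧ instEq Q g h
instEq (false ∷ Q) g h = instEq Q g h

restrict : ∀ {m} (Q : Subset m) → Vec Bool m → Inst Q
restrict [] [] = tt
restrict (true ∷ Q) (b ∷ x) = b , restrict Q x
restrict (false ∷ Q) (_ ∷ x) = restrict Q x

-- A complete CPT for V_n: a parent set and, for each context γ, exactly one
-- rule; rule γ = true means γ : 1 ≻ 0, rule γ = false means γ : 0 ≻ 1.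
record CPT (m : ℕ) : Set where
  constructor cpt
  field
    parents : Subset m
    rule    : Inst parents → Bool
open CPT public

vote : ∀ {m} → CPT m → Vec Bool m → Bool
vote N x = rule N (restrict (parents N) x)

sumVec : ∀ m → (Vec Bool m → ℕ) → ℕ
sumVec zero f = f []
sumVec (suc m) f = sumVec m (λ x → f (false ∷ x)) + sumVec m (λ x → f (true ∷ x))

sumInst : ∀ {m} (Q : Subset m) → (Inst Q → ℕ) → ℕ
sumInst [] f = f tt
sumInst (true ∷ Q) f = sumInst Q (λ g → f (false , g)) + sumInst Q (λ g → f (true , g))
sumInst (false ∷ Q) f = sumInst Q f

sumSubsets : ∀ m → (Subset m → ℕ) → ℕ
sumSubsets m f = sumVec m f

Δ : ∀ {m} → CPT m → CPT m → ℕ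
Δ {m} N N' = sumVec m (λ x → if vote N x xor vote N' x then 1 else 0)

-- The CPT of T^{k,n} indexed by (P, γ): parent set P, rule γ : 1 ≻ 0,
-- and γ' : 0 ≻ 1 for every other γ'.
Nsel : ∀ {m} (P : Subset m) → Inst P → CPT m
Nsel P γ = cpt P (λ γ' → instEq P γ' γ)

fT : ∀ {m} (k : ℕ) → CPT m → ℕ
fT {m} k N = sumSubsets m (λ P → if ∣ P ∣ ≡ᵇ k then sumInst P (λ γ → Δ N (Nsel P γ)) else 0)

Optimal : ∀ {m} (k : ℕ) → CPT m → Set
Optimal {m} k N = ∀ (N' : CPT m) → fT k N ≤ fT k N'

-- Compare both sides with the CPT voting 0 on every swap, which the optimal N
-- cannot beat. For a fixed k-set Q, a swap x voting b disagrees with exactly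
-- one N_(Q,g) if b = 0 and with 2^k − 1 of them if b = 1. With m = n − 1, the all-zero
-- CPT thus costs 2^m per k-set, while N_(P,γ) votes 1 on exactly the 2^(m−k) swaps
-- matching γ and costs 2^(m+1) − 2·2^(m−k) per k-set; this is at least
-- (3/2)·2^m exactly when 2^k ≥ 4.
module Submission where

open import Defs
open import Data.Nat using (ℕ; zero; suc; _+_; _*_; _^_; _∸_; _≤_; z≤n; _≡ᵇ_)
open import Data.Nat.Properties
open import Data.Nat.Tactic.RingSolver using (solve-∀)
open import Data.Bool using (Bool; true; false; if_then_else_; not; _xor_; T)
open import Data.Unit using (tt)
open import Data.Product using (_,_)
open import Data.Vec using (Vec; []; _∷_)
open import Data.Fin.Subset using (Subset; ∣_∣; ⊥)
open import Relation.Binary.PropositionalEquality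
  using (_≡_; refl; sym; trans; cong; cong₂; subst; module ≡-Reasoning)
open import Algebra.Properties.CommutativeSemigroup +-commutativeSemigroup using (interchange)

[_] : Bool → ℕ
[ b ] = if b then 1 else 0

[not]+[]≡1 : ∀ b → [ not b ] + [ b ] ≡ 1
[not]+[]≡1 true = refl
[not]+[]≡1 false = refl

sumVec-cong : ∀ m {f g : Vec Bool m → ℕ} → (∀ x → f x ≡ g x) → sumVec m f ≡ sumVec m g
sumVec-cong zero f≡g = f≡g []
sumVec-cong (suc m) f≡g =
  cong₂ _+_ (sumVec-cong m (λ x → f≡g (false ∷ x))) (sumVec-cong m (λ x → f≡g (true ∷ x)))

sumVec-mono-≤ : ∀ m {f g : Vec Bool m → ℕ} → (∀ x → f x ≤ g x) → sumVec m f ≤ sumVec m g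
sumVec-mono-≤ zero f≤g = f≤g []
sumVec-mono-≤ (suc m) f≤g =
  +-mono-≤ (sumVec-mono-≤ m (λ x → f≤g (false ∷ x))) (sumVec-mono-≤ m (λ x → f≤g (true ∷ x)))

sumVec-distrib-+ : ∀ m (f g : Vec Bool m → ℕ) →
  sumVec m (λ x → f x + g x) ≡ sumVec m f + sumVec m g
sumVec-distrib-+ zero f g = refl
sumVec-distrib-+ (suc m) f g = trans
  (cong₂ _+_ (sumVec-distrib-+ m (λ x → f (false ∷ x)) (λ x → g (false ∷ x)))
             (sumVec-distrib-+ m (λ x → f (true ∷ x)) (λ x → g (true ∷ x))))
  (interchange (sumVec m (λ x → f (false ∷ x))) (sumVec m (λ x → g (false ∷ x))) _ _)

*-distribˡ-sumVec : ∀ m c (f : Vec Bool m → ℕ) → c * sumVec m f ≡ sumVec m (λ x → c * f x)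
*-distribˡ-sumVec zero c f = refl
*-distribˡ-sumVec (suc m) c f =
  trans (*-distribˡ-+ c _ _) (cong₂ _+_ (*-distribˡ-sumVec m c _) (*-distribˡ-sumVec m c _))

sumVec-const : ∀ m c → sumVec m (λ _ → c) ≡ 2 ^ m * c
sumVec-const zero c = sym (*-identityˡ c)
sumVec-const (suc m) c = begin
  sumVec m (λ _ → c) + sumVec m (λ _ → c) ≡⟨ cong₂ _+_ (sumVec-const m c) (sumVec-const m c) ⟩
  2 ^ m * c + 2 ^ m * c                   ≡⟨ cong (2 ^ m * c +_) (sym (+-identityʳ _)) ⟩
  2 * (2 ^ m * c)                         ≡⟨ sym (*-assoc 2 (2 ^ m) c) ⟩
  2 ^ suc m * c                           ∎
  where open ≡-Reasoning

sumInst-cong : ∀ {m} (Q : Subset m) {f g : Inst Q → ℕ} → (∀ γ → f γ ≡ g γ) → sumInst Q f ≡ sumInst Q g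
sumInst-cong [] f≡g = f≡g tt
sumInst-cong (true ∷ Q) f≡g =
  cong₂ _+_ (sumInst-cong Q (λ γ → f≡g (false , γ))) (sumInst-cong Q (λ γ → f≡g (true , γ)))
sumInst-cong (false ∷ Q) f≡g = sumInst-cong Q f≡g

sumInst-distrib-+ : ∀ {m} (Q : Subset m) (f g : Inst Q → ℕ) →
  sumInst Q (λ γ → f γ + g γ) ≡ sumInst Q f + sumInst Q g
sumInst-distrib-+ [] f g = refl
sumInst-distrib-+ (true ∷ Q) f g = trans
  (cong₂ _+_ (sumInst-distrib-+ Q (λ γ → f (false , γ)) (λ γ → g (false , γ)))
             (sumInst-distrib-+ Q (λ γ → f (true , γ)) (λ γ → g (true , γ))))
  (interchange (sumInst Q (λ γ → f (false , γ))) (sumInst Q (λ γ → g (false , γ))) _ _)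
sumInst-distrib-+ (false ∷ Q) f g = sumInst-distrib-+ Q f g

sumInst-const : ∀ {m} (Q : Subset m) c → sumInst Q (λ _ → c) ≡ 2 ^ ∣ Q ∣ * c
sumInst-const [] c = sym (*-identityˡ c)
sumInst-const (true ∷ Q) c = begin
  sumInst Q (λ _ → c) + sumInst Q (λ _ → c) ≡⟨ cong₂ _+_ (sumInst-const Q c) (sumInst-const Q c) ⟩
  2 ^ ∣ Q ∣ * c + 2 ^ ∣ Q ∣ * c             ≡⟨ cong (2 ^ ∣ Q ∣ * c +_) (sym (+-identityʳ _)) ⟩
  2 * (2 ^ ∣ Q ∣ * c)                       ≡⟨ sym (*-assoc 2 (2 ^ ∣ Q ∣) c) ⟩
  2 ^ suc ∣ Q ∣ * c                         ∎
  where open ≡-Reasoning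
sumInst-const (false ∷ Q) c = sumInst-const Q c

sumInst-zero : ∀ {m} (Q : Subset m) → sumInst Q (λ _ → 0) ≡ 0
sumInst-zero Q = trans (sumInst-const Q 0) (*-zeroʳ (2 ^ ∣ Q ∣))

sumInst-sumVec-comm : ∀ {j m} (Q : Subset j) (f : Inst Q → Vec Bool m → ℕ) →
  sumInst Q (λ γ → sumVec m (f γ)) ≡ sumVec m (λ x → sumInst Q (λ γ → f γ x))
sumInst-sumVec-comm [] f = refl
sumInst-sumVec-comm {m = m} (true ∷ Q) f = trans
  (cong₂ _+_ (sumInst-sumVec-comm Q (λ γ → f (false , γ))) (sumInst-sumVec-comm Q (λ γ → f (true , γ))))
  (sym (sumVec-distrib-+ m _ _))
sumInst-sumVec-comm (false ∷ Q) f = sumInst-sumVec-comm Q f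

-- Every context of P is the restriction of exactly 2^(m − |P|) swaps.
sumVec-restrict : ∀ {m} (P : Subset m) (f : Inst P → ℕ) →
  2 ^ ∣ P ∣ * sumVec m (λ x → f (restrict P x)) ≡ 2 ^ m * sumInst P f
sumVec-restrict [] f = refl
sumVec-restrict {suc m} (true ∷ P) f = begin
  2 * p * (s₀ + s₁)                   ≡⟨ double-distrib p s₀ s₁ ⟩
  2 * (p * s₀ + p * s₁)               ≡⟨ cong (2 *_) (cong₂ _+_ (sumVec-restrict P f₀) (sumVec-restrict P f₁)) ⟩
  2 * (2 ^ m * i₀ + 2 ^ m * i₁)       ≡⟨ sym (double-distrib (2 ^ m) i₀ i₁) ⟩
  2 * 2 ^ m * (i₀ + i₁)               ∎
  where
  open ≡-Reasoning
  double-distrib : ∀ a b c → 2 * a * (b + c) ≡ 2 * (a * b + a * c)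
  double-distrib = solve-∀
  p s₀ s₁ i₀ i₁ : ℕ
  p = 2 ^ ∣ P ∣
  f₀ f₁ : Inst P → ℕ
  f₀ γ = f (false , γ)
  f₁ γ = f (true , γ)
  s₀ = sumVec m (λ x → f₀ (restrict P x))
  s₁ = sumVec m (λ x → f₁ (restrict P x))
  i₀ = sumInst P f₀
  i₁ = sumInst P f₁
sumVec-restrict {suc m} (false ∷ P) f = begin
  2 ^ ∣ P ∣ * (s + s)                 ≡⟨ *-distribˡ-+ (2 ^ ∣ P ∣) s s ⟩
  2 ^ ∣ P ∣ * s + 2 ^ ∣ P ∣ * s       ≡⟨ cong₂ _+_ (sumVec-restrict P f) (sumVec-restrict P f) ⟩
  2 ^ m * i + 2 ^ m * i               ≡⟨ sym (*-distribʳ-+ i (2 ^ m) (2 ^ m)) ⟩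
  (2 ^ m + 2 ^ m) * i                 ≡⟨ cong (λ z → (2 ^ m + z) * i) (sym (+-identityʳ (2 ^ m))) ⟩
  2 * 2 ^ m * i                       ∎
  where
  open ≡-Reasoning
  s i : ℕ
  s = sumVec m (λ x → f (restrict P x))
  i = sumInst P f

instEq-sym : ∀ {m} (Q : Subset m) (γ δ : Inst Q) → instEq Q γ δ ≡ instEq Q δ γ
instEq-sym [] _ _ = refl
instEq-sym (true ∷ Q) (false , γ) (false , δ) = instEq-sym Q γ δ
instEq-sym (true ∷ Q) (false , γ) (true , δ) = refl
instEq-sym (true ∷ Q) (true , γ) (false , δ) = refl
instEq-sym (true ∷ Q) (true , γ) (true , δ) = instEq-sym Q γ δ
instEq-sym (false ∷ Q) γ δ = instEq-sym Q γ δ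

sumInst-instEq : ∀ {m} (Q : Subset m) (γ : Inst Q) → sumInst Q (λ δ → [ instEq Q γ δ ]) ≡ 1
sumInst-instEq [] γ = refl
sumInst-instEq (true ∷ Q) (false , γ) = cong₂ _+_ (sumInst-instEq Q γ) (sumInst-zero Q)
sumInst-instEq (true ∷ Q) (true , γ) = cong₂ _+_ (sumInst-zero Q) (sumInst-instEq Q γ)
sumInst-instEq (false ∷ Q) γ = sumInst-instEq Q γ

-- That is 1 for b = false and 2^|Q| − 1 for b = true, moved to avoid truncated subtraction.
sumInst-xor-instEq : ∀ {m} (Q : Subset m) (γ : Inst Q) b →
  sumInst Q (λ δ → [ b xor instEq Q γ δ ]) + 2 * [ b ] ≡ 1 + 2 ^ ∣ Q ∣ * [ b ]
sumInst-xor-instEq Q γ false = begin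
  sumInst Q (λ δ → [ instEq Q γ δ ]) + 0 ≡⟨ trans (+-identityʳ _) (sumInst-instEq Q γ) ⟩
  1                                      ≡⟨ cong (1 +_) (sym (*-zeroʳ (2 ^ ∣ Q ∣))) ⟩
  1 + 2 ^ ∣ Q ∣ * 0                      ∎
  where open ≡-Reasoning
sumInst-xor-instEq Q γ true = begin
  s≢ + 2                 ≡⟨ cong (λ z → s≢ + (z + 1)) (sym (sumInst-instEq Q γ)) ⟩
  s≢ + (s≡ + 1)          ≡⟨ sym (+-assoc s≢ s≡ 1) ⟩
  s≢ + s≡ + 1            ≡⟨ cong (_+ 1) (sym (sumInst-distrib-+ Q _ _)) ⟩
  sumInst Q (λ δ → [ not (instEq Q γ δ) ] + [ instEq Q γ δ ]) + 1
                         ≡⟨ cong (_+ 1) (sumInst-cong Q (λ δ → [not]+[]≡1 (instEq Q γ δ))) ⟩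
  sumInst Q (λ _ → 1) + 1 ≡⟨ cong (_+ 1) (sumInst-const Q 1) ⟩
  2 ^ ∣ Q ∣ * 1 + 1      ≡⟨ +-comm _ 1 ⟩
  1 + 2 ^ ∣ Q ∣ * 1      ∎
  where
  open ≡-Reasoning
  s≢ s≡ : ℕ
  s≢ = sumInst Q (λ δ → [ not (instEq Q γ δ) ])
  s≡ = sumInst Q (λ δ → [ instEq Q γ δ ])

ones : ∀ {m} → CPT m → ℕ
ones {m} N = sumVec m (λ x → [ vote N x ])

cost : ∀ {m} → CPT m → Subset m → ℕ
cost N Q = sumInst Q (λ γ → Δ N (Nsel Q γ))

cost-+-ones : ∀ {m} (N : CPT m) (Q : Subset m) →
  cost N Q + 2 * ones N ≡ 2 ^ m + 2 ^ ∣ Q ∣ * ones N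
cost-+-ones {m} N Q = begin
  cost N Q + 2 * ones N
    ≡⟨ cong₂ _+_ (sumInst-sumVec-comm Q (λ γ x → [ disagree x γ ])) (*-distribˡ-sumVec m 2 _) ⟩
  sumVec m (λ x → sumInst Q (λ γ → [ disagree x γ ])) + sumVec m (λ x → 2 * [ vote N x ])
    ≡⟨ sym (sumVec-distrib-+ m _ _) ⟩
  sumVec m (λ x → sumInst Q (λ γ → [ disagree x γ ]) + 2 * [ vote N x ])
    ≡⟨ sumVec-cong m (λ x → sumInst-xor-instEq Q (restrict Q x) (vote N x)) ⟩
  sumVec m (λ x → 1 + 2 ^ ∣ Q ∣ * [ vote N x ])
    ≡⟨ sumVec-distrib-+ m (λ _ → 1) (λ x → 2 ^ ∣ Q ∣ * [ vote N x ]) ⟩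
  sumVec m (λ _ → 1) + sumVec m (λ x → 2 ^ ∣ Q ∣ * [ vote N x ])
    ≡⟨ cong₂ _+_ (trans (sumVec-const m 1) (*-identityʳ (2 ^ m)))
                 (sym (*-distribˡ-sumVec m (2 ^ ∣ Q ∣) (λ x → [ vote N x ]))) ⟩
  2 ^ m + 2 ^ ∣ Q ∣ * ones N
    ∎
  where
  open ≡-Reasoning
  disagree : Vec Bool m → Inst Q → Bool
  disagree x γ = vote N x xor vote (Nsel Q γ) x

allZero : ∀ {m} → CPT m
allZero = cpt ⊥ (λ _ → false)

cost-allZero : ∀ {m} (Q : Subset m) → cost allZero Q ≡ 2 ^ m
cost-allZero {m} Q = begin
  cost Z Q                    ≡⟨ sym (+-identityʳ _) ⟩
  cost Z Q + 2 * 0            ≡⟨ cong (λ z → cost Z Q + 2 * z) (sym ones-Z) ⟩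
  cost Z Q + 2 * ones Z       ≡⟨ cost-+-ones Z Q ⟩
  2 ^ m + 2 ^ ∣ Q ∣ * ones Z  ≡⟨ cong (λ z → 2 ^ m + 2 ^ ∣ Q ∣ * z) ones-Z ⟩
  2 ^ m + 2 ^ ∣ Q ∣ * 0       ≡⟨ cong (2 ^ m +_) (*-zeroʳ (2 ^ ∣ Q ∣)) ⟩
  2 ^ m + 0                   ≡⟨ +-identityʳ _ ⟩
  2 ^ m                       ∎
  where
  open ≡-Reasoning
  Z : CPT m
  Z = allZero
  ones-Z : ones Z ≡ 0
  ones-Z = trans (sumVec-const m 0) (*-zeroʳ (2 ^ m))

ones-Nsel : ∀ {m} (P : Subset m) (γ : Inst P) → 2 ^ ∣ P ∣ * ones (Nsel P γ) ≡ 2 ^ m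
ones-Nsel {m} P γ = begin
  2 ^ ∣ P ∣ * ones (Nsel P γ)                ≡⟨ sumVec-restrict P (λ δ → [ instEq P δ γ ]) ⟩
  2 ^ m * sumInst P (λ δ → [ instEq P δ γ ]) ≡⟨ cong (2 ^ m *_) (sumInst-cong P (λ δ → cong [_] (instEq-sym P δ γ))) ⟩
  2 ^ m * sumInst P (λ δ → [ instEq P γ δ ]) ≡⟨ cong (2 ^ m *_) (sumInst-instEq P γ) ⟩
  2 ^ m * 1                                  ≡⟨ *-identityʳ _ ⟩
  2 ^ m                                      ∎
  where open ≡-Reasoning

3*M≤2*S : ∀ M S a p → S + 2 * a ≡ M + p * a → p * a ≡ M → 4 ≤ p → 3 * M ≤ 2 * S
3*M≤2*S M S a p balance pa≡M 4≤p = +-cancelʳ-≤ (4 * a) (3 * M) (2 * S) (begin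
  3 * M + 4 * a       ≤⟨ +-monoʳ-≤ (3 * M) (*-monoˡ-≤ a 4≤p) ⟩
  3 * M + p * a       ≡⟨ cong (3 * M +_) pa≡M ⟩
  3 * M + M           ≡⟨ four-halves M ⟩
  2 * (M + M)         ≡⟨ cong (λ z → 2 * (M + z)) (sym pa≡M) ⟩
  2 * (M + p * a)     ≡⟨ cong (2 *_) (sym balance) ⟩
  2 * (S + 2 * a)     ≡⟨ distrib S a ⟩
  2 * S + 4 * a       ∎)
  where
  open ≤-Reasoning
  four-halves : ∀ M → 3 * M + M ≡ 2 * (M + M)
  four-halves = solve-∀
  distrib : ∀ S a → 2 * (S + 2 * a) ≡ 2 * S + 4 * a
  distrib = solve-∀

cost-allZero-≤-cost-Nsel : ∀ {m} (P Q : Subset m) (γ : Inst P) → ∣ Q ∣ ≡ ∣ P ∣ → 2 ≤ ∣ P ∣ →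
  3 * cost allZero Q ≤ 2 * cost (Nsel P γ) Q
cost-allZero-≤-cost-Nsel {m} P Q γ ∣Q∣≡∣P∣ 2≤∣P∣ =
  subst (λ z → 3 * z ≤ 2 * cost (Nsel P γ) Q) (sym (cost-allZero Q))
    (3*M≤2*S (2 ^ m) (cost (Nsel P γ) Q) (ones (Nsel P γ)) (2 ^ ∣ P ∣)
      (subst (λ j → cost (Nsel P γ) Q + 2 * ones (Nsel P γ) ≡ 2 ^ m + 2 ^ j * ones (Nsel P γ))
        ∣Q∣≡∣P∣ (cost-+-ones (Nsel P γ) Q))
      (ones-Nsel P γ)
      (^-monoʳ-≤ 2 2≤∣P∣))

theorem18 : ∀ (n : ℕ) → 3 ≤ n → ∀ (k : ℕ) → 2 ≤ k → k ≤ n ∸ 1 →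
    ∀ (P : Subset (n ∸ 1)) → ∣ P ∣ ≡ k → ∀ (γ : Inst P) →
    ∀ (N : CPT (n ∸ 1)) → Optimal k N →
    3 * fT k N ≤ 2 * fT k (Nsel P γ)
theorem18 n _ k 2≤k _ P ∣P∣≡k γ N optimal = begin
  3 * fT k N                              ≤⟨ *-monoʳ-≤ 3 (optimal N₀) ⟩
  3 * fT k N₀                             ≡⟨ *-distribˡ-sumVec m 3 (level N₀) ⟩
  sumVec m (λ Q → 3 * level N₀ Q)         ≤⟨ sumVec-mono-≤ m level-bound ⟩
  sumVec m (λ Q → 2 * level (Nsel P γ) Q) ≡⟨ sym (*-distribˡ-sumVec m 2 (level (Nsel P γ))) ⟩
  2 * fT k (Nsel P γ)                     ∎
  where
  open ≤-Reasoning
  m : ℕ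
  m = n ∸ 1
  N₀ : CPT m
  N₀ = allZero
  level : CPT m → Subset m → ℕ
  level N Q = if ∣ Q ∣ ≡ᵇ k then cost N Q else 0
  level-bound : ∀ Q → 3 * level N₀ Q ≤ 2 * level (Nsel P γ) Q
  level-bound Q with ∣ Q ∣ ≡ᵇ k in eq
  ... | false = z≤n
  ... | true = cost-allZero-≤-cost-Nsel P Q γ
    (trans (≡ᵇ⇒≡ ∣ Q ∣ k (subst T (sym eq) tt)) (sym ∣P∣≡k)) (subst (2 ≤_) (sym ∣P∣≡k) 2≤k)
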